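{- Let $V$ be a finite set, let $q\in\Pi(V)$, and let $X\subseteq V$ be such that no subset of $X$ is a block of $q$. Then for every $p\in\Pi(V\setminus X)$: $$p_{\uparrow V}\sqcup q=\{V\}\iff p\sqcup q_{\downarrow(V\setminus X)}=\{V\setminus X\},$$ and $$\textsf{acyclic}(p_{\uparrow V},q)\iff\textsf{acyclic}(p,q_{\downarrow(V\setminus X)}).$$
   Context: $\Pi(V)$ is the set of partitions of $V$. For $p,q\in\Pi(W)$ ($W$ finite), $p\sqcup q$ is the join in the refinement lattice (finest partition coarser than both), $\#p$ is the number of blocks, and $\textsf{acyclic}(p,q)$ holds iff $|W|+\#(p\sqcup q)-(\#p+\#q)=0$. For $q\in\Pi(V)$ and $Z\subseteq V$, $q_{\downarrow Z}=\{B\cap Z\mid B\in q\}\setminus\{\emptyset\}\in\Pi(Z)$. For $p\in\Pi(W)$ and $Y\supseteq W$, $p_{\uparrow Y}=p\cup\{\{y\}\mid y\in Y\setminus W\}\in\Pi(Y)$. -}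

module Defs where

open import Data.Nat using (ℕ; _+_)
open import Data.Fin using (Fin)
open import Data.Fin.Subset
  using (Subset; _∈_; _∉_; _⊆_; _∩_; ∁; ⊤; ⁅_⁆; ∣_∣; Nonempty; Empty)
open import Data.List using (List; length; _∷_; [])
open import Data.List.Relation.Unary.All using (All)
open import Data.List.Relation.Unary.Any using (Any)
open import Data.List.Relation.Unary.AllPairs using (AllPairs)
import Data.List.Membership.Propositional as LM
open import Data.Product using (Σ; _×_; ∃)
open import Data.Sum using (_⊎_)
open import Relation.Binary.PropositionalEquality using (_≡_)
open import Function.Bundles using (_⇔_)

-- The finite ground set V is modelled as Fin n; subsets of V are Subset n.

_∈ᴸ_ : ∀ {n} → Subset n → List (Subset n) → Set
B ∈ᴸ Bs = B LM.∈ Bs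

-- A partition of W ⊆ Fin n: a list of nonempty, pairwise disjoint
-- blocks whose union is W.  (Pairwise disjoint + nonempty forces the
-- blocks to be distinct, so the length of the list is the number of blocks.)
record Partition {n : ℕ} (W : Subset n) : Set where
  field
    blocks   : List (Subset n)
    nonempty : All Nonempty blocks
    disjoint : AllPairs (λ A B → Empty (A ∩ B)) blocks
    cover    : ∀ (x : Fin n) → (x ∈ W) ⇔ Any (λ B → x ∈ B) blocks
open Partition public

#_ : ∀ {n} {W : Subset n} → Partition W → ℕ
# p = length (blocks p)

_≼_ : ∀ {n} {W : Subset n} → Partition W → Partition W → Set
p ≼ r = All (λ B → Any (λ C → B ⊆ C) (blocks r)) (blocks p)

IsJoin : ∀ {n} {W : Subset n} → Partition W → Partition W → Partition W → Set
IsJoin {W = W} p q r =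
  p ≼ r × q ≼ r × (∀ (s : Partition W) → p ≼ s → q ≼ s → r ≼ s)

IsSingleBlock : ∀ {n} {W : Subset n} → Partition W → Set
IsSingleBlock {W = W} r = ∀ C → (C ∈ᴸ blocks r) ⇔ (C ≡ W)

IsRestriction : ∀ {n} {V Z : Subset n} → Partition V → Partition Z → Set
IsRestriction {Z = Z} q r =
  ∀ C → (C ∈ᴸ blocks r) ⇔ ((Σ (Subset _) λ B → B ∈ᴸ blocks q × C ≡ B ∩ Z) × Nonempty C)

IsLift : ∀ {n} {W Y : Subset n} → Partition W → Partition Y → Set
IsLift {n} {W} {Y} p r =
  ∀ C → (C ∈ᴸ blocks r) ⇔ (C ∈ᴸ blocks p ⊎ (Σ (Fin n) λ y → y ∈ Y × y ∉ W × C ≡ ⁅ y ⁆))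

-- acyclic(p, q) given the join r = p ⊔ q:
--   |W| + #(p ⊔ q) − (#p + #q) = 0   (stated additively, over ℕ)
AcyclicWith : ∀ {n} {W : Subset n} → Partition W → Partition W → Partition W → Set
AcyclicWith {W = W} p q r = ∣ W ∣ + # r ≡ # p + # q

-- Write Y = V ∖ X. Every block of q meets Y, hence so does every block of the coarser
-- partition j₁ = p↑V ⊔ q, and restricting to Y loses none of their blocks. The heart of the
-- argument is j₁↓Y = j₂ = p ⊔ q↓Y: j₁↓Y is coarser than p and q↓Y, so j₂ refines it; conversely,
-- gluing to each block of j₂ the q-blocks that meet it gives a partition of V coarser than p↑V
-- and q, so j₁ refines it, and tracing back to Y shows that j₁↓Y refines j₂. Consequently j₁ and
-- j₂ have equally many blocks and one is a single block iff the other is, while #(p↑V) = #p + |X|,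
-- #(q↓Y) = #q and |V| = |X| + |Y|, so the two acyclicity equations differ by |X| on each side.

module Submission where

open import Defs
open import Data.Nat using (ℕ)
open import Data.Fin.Subset using (Subset; _⊆_; ∁; ⊤)
open import Data.Product using (_×_)
open import Relation.Nullary using (¬_)
open import Function.Bundles using (_⇔_)

open import Data.Nat using (_+_; _∸_)
open import Data.Nat.Properties using (+-assoc; +-comm; +-cancelˡ-≡; m+[n∸m]≡n)
open import Data.Fin using (Fin; zero; suc)
open import Data.Fin.Properties using (suc-injective)
open import Data.Fin.Subset using (_∈_; _∉_; _∩_; ⋃; ⁅_⁆; ∣_∣; Nonempty; Empty; inside; outside)
open import Data.Fin.Subset.Properties
  using (nonempty?; ∈⊤; ⊆⊤; ∉⊥; ⊆-antisym; p∩q⊆p; p∩q⊆q; x∈p∩q⁺; x∈p∩q⁻; x∈p∪q⁺; x∈p∪q⁻;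
         x∈⁅x⁆; x∈⁅y⁆⇒x≡y; x∈p⇒x∉∁p; x∉∁p⇒x∈p; ∣⊤∣≡n; ∣∁p∣≡n∸∣p∣; ∣p∣≤n)
import Data.Vec as Vec
open import Data.List using (List; []; _∷_; map; filter; length; _++_)
open import Data.List.Properties using (length-++; length-map)
open import Data.List.Relation.Unary.All as All using (All; []; _∷_)
import Data.List.Relation.Unary.All.Properties as All
open import Data.List.Relation.Unary.Any using (Any; here; there)
import Data.List.Relation.Unary.Any.Properties as Any
open import Data.List.Relation.Unary.AllPairs as AllPairs using (AllPairs; []; _∷_)
import Data.List.Relation.Unary.AllPairs.Properties as AllPairs
open import Data.List.Relation.Unary.Unique.Propositional using (Unique)
import Data.List.Relation.Unary.Unique.Propositional.Properties as Unique
open import Data.List.Membership.Propositional using (find; lose) renaming (_∈_ to _∈ₗ_)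
open import Data.List.Membership.Propositional.Properties
  using (∈-map⁺; ∈-map⁻; ∈-filter⁺; ∈-filter⁻; ∈-++⁺ˡ; ∈-++⁺ʳ; ∈-++⁻)
open import Data.List.Membership.Propositional.Properties.WithK using (unique∧set⇒bag)
open import Data.List.Relation.Binary.BagAndSetEquality using (∼bag⇒↭)
open import Data.List.Relation.Binary.Permutation.Propositional.Properties using (↭-length)
open import Data.Product using (Σ; ∃; _,_; proj₁; proj₂)
open import Data.Sum using (_⊎_; inj₁; inj₂)
open import Data.Empty using (⊥; ⊥-elim)
open import Relation.Nullary.Decidable using (decidable-stable)
open import Relation.Binary.PropositionalEquality
open import Function using (_∘_; id)
open import Function.Bundles using (mk⇔; Equivalence)
import Function.Properties.Equivalence as ⇔

∣⊤∣≡∣p∣+∣∁p∣ : ∀ {n} (A : Subset n) → ∣ ⊤ {n} ∣ ≡ ∣ A ∣ + ∣ ∁ A ∣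
∣⊤∣≡∣p∣+∣∁p∣ {n} A = begin
  ∣ ⊤ {n} ∣           ≡⟨ ∣⊤∣≡n n ⟩
  n                   ≡⟨ m+[n∸m]≡n (∣p∣≤n A) ⟨
  ∣ A ∣ + (n ∸ ∣ A ∣) ≡⟨ cong (∣ A ∣ +_) (∣∁p∣≡n∸∣p∣ A) ⟨
  ∣ A ∣ + ∣ ∁ A ∣     ∎
  where open ≡-Reasoning

elements : ∀ {n} → Subset n → List (Fin n)
elements Vec.[]            = []
elements (inside  Vec.∷ A) = zero ∷ map suc (elements A)
elements (outside Vec.∷ A) = map suc (elements A)

length-elements : ∀ {n} (A : Subset n) → length (elements A) ≡ ∣ A ∣
length-elements Vec.[]            = refl
length-elements (inside  Vec.∷ A) = cong ℕ.suc (trans (length-map suc (elements A)) (length-elements A))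
length-elements (outside Vec.∷ A) = trans (length-map suc (elements A)) (length-elements A)

∈-elements⁺ : ∀ {n} (A : Subset n) {x : Fin n} → x ∈ A → x ∈ₗ elements A
∈-elements⁺ (inside  Vec.∷ A) Vec.here        = here refl
∈-elements⁺ (inside  Vec.∷ A) (Vec.there x∈A) = there (∈-map⁺ suc (∈-elements⁺ A x∈A))
∈-elements⁺ (outside Vec.∷ A) (Vec.there x∈A) = ∈-map⁺ suc (∈-elements⁺ A x∈A)

∈-elements⁻ : ∀ {n} (A : Subset n) {x : Fin n} → x ∈ₗ elements A → x ∈ A
∈-elements⁻ (inside Vec.∷ A) (here refl) = Vec.here
∈-elements⁻ (inside Vec.∷ A) (there x∈) with ∈-map⁻ suc x∈
... | _ , x∈A , refl = Vec.there (∈-elements⁻ A x∈A)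
∈-elements⁻ (outside Vec.∷ A) x∈ with ∈-map⁻ suc x∈
... | _ , x∈A , refl = Vec.there (∈-elements⁻ A x∈A)

elements-unique : ∀ {n} (A : Subset n) → Unique (elements A)
elements-unique Vec.[]            = []
elements-unique (inside  Vec.∷ A) =
  All.map⁺ (All.tabulate λ _ ()) ∷ Unique.map⁺ suc-injective (elements-unique A)
elements-unique (outside Vec.∷ A) = Unique.map⁺ suc-injective (elements-unique A)

length-≡ : ∀ {X : Set} {xs ys : List X} → Unique xs → Unique ys →
           (∀ {z} → z ∈ₗ xs ⇔ z ∈ₗ ys) → length xs ≡ length ys
length-≡ xs! ys! xs≈ys = ↭-length (∼bag⇒↭ (unique∧set⇒bag xs! ys! xs≈ys))

AllPairs-map-within : ∀ {X : Set} {P : X → Set} {R S : X → X → Set} {xs : List X} →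
  All P xs → (∀ {a b} → P a → P b → R a b → S a b) → AllPairs R xs → AllPairs S xs
AllPairs-map-within []         f []         = []
AllPairs-map-within (pa ∷ pxs) f (ra ∷ rxs) =
  All.zipWith (λ (pb , rab) → f pa pb rab) (pxs , ra) ∷ AllPairs-map-within pxs f rxs

module _ {n : ℕ} where

  private variable
    x y : Fin n
    A B C D V W Y Z : Subset n
    Bs : List (Subset n)

  Disjoint : Subset n → Subset n → Set
  Disjoint A B = Empty (A ∩ B)

  ∈-⋃⁺ : Any (x ∈_) Bs → x ∈ ⋃ Bs
  ∈-⋃⁺ (here x∈B)   = x∈p∪q⁺ (inj₁ x∈B)
  ∈-⋃⁺ (there x∈Bs) = x∈p∪q⁺ (inj₂ (∈-⋃⁺ x∈Bs))

  ∈-⋃⁻ : ∀ (Bs : List (Subset n)) → x ∈ ⋃ Bs → Any (x ∈_) Bs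
  ∈-⋃⁻ []       x∈ = ⊥-elim (∉⊥ x∈)
  ∈-⋃⁻ (B ∷ Bs) x∈ with x∈p∪q⁻ B (⋃ Bs) x∈
  ... | inj₁ x∈B   = here x∈B
  ... | inj₂ x∈⋃Bs = there (∈-⋃⁻ Bs x∈⋃Bs)

  ⊆⇒∩≡ : Z ⊆ V → V ∩ Z ≡ Z
  ⊆⇒∩≡ {V = V} Z⊆V = ⊆-antisym (p∩q⊆q V _) (λ x∈Z → x∈p∩q⁺ (Z⊆V x∈Z , x∈Z))

  ⊈⇒meets-∁ : ¬ (B ⊆ A) → Nonempty (B ∩ ∁ A)
  ⊈⇒meets-∁ {B = B} {A} B⊈A = decidable-stable (nonempty? (B ∩ ∁ A)) λ B∩∁A-empty →
    B⊈A λ x∈B → x∉∁p⇒x∈p λ x∈∁A → B∩∁A-empty (_ , x∈p∩q⁺ (x∈B , x∈∁A))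

  disjoint-≡ : AllPairs Disjoint Bs → B ∈ᴸ Bs → C ∈ᴸ Bs → x ∈ B → x ∈ C → B ≡ C
  disjoint-≡ (_ ∷ _)   (here refl) (here refl) _ _     = refl
  disjoint-≡ (B#Bs ∷ _) (here refl) (there C∈) x∈B x∈C = ⊥-elim (All.lookup B#Bs C∈ (_ , x∈p∩q⁺ (x∈B , x∈C)))
  disjoint-≡ (B#Bs ∷ _) (there B∈) (here refl) x∈B x∈C = ⊥-elim (All.lookup B#Bs B∈ (_ , x∈p∩q⁺ (x∈C , x∈B)))
  disjoint-≡ (_ ∷ Bs#) (there B∈) (there C∈) x∈B x∈C   = disjoint-≡ Bs# B∈ C∈ x∈B x∈C

  nonempty∧disjoint⇒unique : All Nonempty Bs → AllPairs Disjoint Bs → Unique Bs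
  nonempty∧disjoint⇒unique []                 []          = []
  nonempty∧disjoint⇒unique ((z , z∈B) ∷ Bs≠∅) (B#Bs ∷ Bs#) =
    All.map (λ B#C B≡C → B#C (z , x∈p∩q⁺ (z∈B , subst (z ∈_) B≡C z∈B))) B#Bs
      ∷ nonempty∧disjoint⇒unique Bs≠∅ Bs#

  ∩-disjoint : ∀ (Z : Subset n) → Disjoint A B → Disjoint (A ∩ Z) (B ∩ Z)
  ∩-disjoint {A = A} {B} Z A#B (z , z∈) with x∈p∩q⁻ (A ∩ Z) (B ∩ Z) z∈
  ... | z∈A∩Z , z∈B∩Z = A#B (z , x∈p∩q⁺ (proj₁ (x∈p∩q⁻ A Z z∈A∩Z) , proj₁ (x∈p∩q⁻ B Z z∈B∩Z)))

  module _ (P : Partition W) where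

    block-containing : x ∈ W → ∃ λ B → B ∈ᴸ blocks P × x ∈ B
    block-containing {x = x} x∈W = find (Equivalence.to (cover P x) x∈W)

    block⊆ : B ∈ᴸ blocks P → B ⊆ W
    block⊆ B∈ {x} x∈B = Equivalence.from (cover P x) (lose B∈ x∈B)

    blocks-≡ : B ∈ᴸ blocks P → C ∈ᴸ blocks P → x ∈ B → x ∈ C → B ≡ C
    blocks-≡ = disjoint-≡ (disjoint P)

    blocks-unique : Unique (blocks P)
    blocks-unique = nonempty∧disjoint⇒unique (nonempty P) (disjoint P)

    #-≡-length : Unique Bs → (∀ {C} → C ∈ᴸ blocks P ⇔ C ∈ᴸ Bs) → # P ≡ length Bs
    #-≡-length = length-≡ blocks-unique

  AllBlocksMeet : Partition W → Subset n → Set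
  AllBlocksMeet P Z = ∀ {B} → B ∈ᴸ blocks P → Nonempty (B ∩ Z)

  -- Refinement of block lists, so that partitions of different ground sets can be compared
  -- (and the lists, unlike the partitions, are recovered by unification); P ≼ Q unfolds to
  -- blocks P ⊑ blocks Q.
  _⊑_ : List (Subset n) → List (Subset n) → Set
  Bs ⊑ Cs = All (λ B → Any (B ⊆_) Cs) Bs

  coarser-block : ∀ {Cs} → Bs ⊑ Cs → B ∈ᴸ Bs → ∃ λ C → C ∈ᴸ Cs × B ⊆ C
  coarser-block Bs⊑Cs B∈ = find (All.lookup Bs⊑Cs B∈)

  ⊑-trans : ∀ {As Cs} → As ⊑ Bs → Bs ⊑ Cs → As ⊑ Cs
  ⊑-trans As⊑Bs Bs⊑Cs = All.tabulate λ A∈ →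
    let (B , B∈ , A⊆B) = coarser-block As⊑Bs A∈
        (C , C∈ , B⊆C) = coarser-block Bs⊑Cs B∈
    in lose C∈ (B⊆C ∘ A⊆B)

  ⊑-antisym : ∀ (P : Partition W) {Cs} → blocks P ⊑ Cs → Cs ⊑ blocks P → C ∈ᴸ blocks P → C ∈ᴸ Cs
  ⊑-antisym P P⊑Cs Cs⊑P C∈ with coarser-block P⊑Cs C∈
  ... | D , D∈ , C⊆D with coarser-block Cs⊑P D∈ | All.lookup (nonempty P) C∈
  ... | C' , C'∈ , D⊆C' | z , z∈C with blocks-≡ P C∈ C'∈ z∈C (D⊆C' (C⊆D z∈C))
  ... | refl = subst (_∈ᴸ _) (⊆-antisym D⊆C' C⊆D) D∈

  ⊑-meets : ∀ (q P : Partition V) → blocks q ⊑ blocks P → AllBlocksMeet q Z → AllBlocksMeet P Z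
  ⊑-meets q P q⊑P q-meets D∈ with All.lookup (nonempty P) D∈
  ... | x , x∈D with block-containing q (block⊆ P D∈ x∈D)
  ... | B , B∈ , x∈B with coarser-block q⊑P B∈ | q-meets B∈
  ... | D' , D'∈ , B⊆D' | y , y∈B∩Z with blocks-≡ P D'∈ D∈ (B⊆D' x∈B) x∈D
  ... | refl = y , x∈p∩q⁺ (B⊆D' (proj₁ (x∈p∩q⁻ B _ y∈B∩Z)) , proj₂ (x∈p∩q⁻ B _ y∈B∩Z))

  module Lift (p : Partition W) (pu : Partition Y) (lift : IsLift p pu) where

    ⊑-lift : blocks p ⊑ blocks pu
    ⊑-lift = All.tabulate λ {A} A∈ → lose (Equivalence.from (lift A) (inj₁ A∈)) id

    lift-⊑ : (s : Partition Y) → blocks p ⊑ blocks s → blocks pu ⊑ blocks s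
    lift-⊑ s p⊑s = All.tabulate λ {A} A∈ → within-block (Equivalence.to (lift A) A∈)
      where
      within-block : A ∈ᴸ blocks p ⊎ (Σ (Fin n) λ y → y ∈ Y × y ∉ W × A ≡ ⁅ y ⁆) → Any (A ⊆_) (blocks s)
      within-block (inj₁ A∈) = All.lookup p⊑s A∈
      within-block (inj₂ (y , y∈Y , _ , refl)) =
        let (C , C∈ , y∈C) = block-containing s y∈Y
        in lose C∈ λ x∈⁅y⁆ → subst (_∈ C) (sym (x∈⁅y⁆⇒x≡y y x∈⁅y⁆)) y∈C

    #-lift : ∀ (S : Subset n) → (∀ y → y ∈ S ⇔ (y ∈ Y × y ∉ W)) → # pu ≡ # p + ∣ S ∣
    #-lift S S≡Y∖W = begin
      # pu                                      ≡⟨ #-≡-length pu blocks! (mk⇔ ⇒ ⇐) ⟩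
      length (blocks p ++ map ⁅_⁆ (elements S)) ≡⟨ length-++ (blocks p) ⟩
      # p + length (map ⁅_⁆ (elements S))       ≡⟨ cong (# p +_) (length-map ⁅_⁆ (elements S)) ⟩
      # p + length (elements S)                 ≡⟨ cong (# p +_) (length-elements S) ⟩
      # p + ∣ S ∣                               ∎
      where
      open ≡-Reasoning
      ⁅⁆-injective : ⁅ x ⁆ ≡ ⁅ y ⁆ → x ≡ y
      ⁅⁆-injective {x} {y} eq = x∈⁅y⁆⇒x≡y y (subst (x ∈_) eq (x∈⁅x⁆ x))
      singleton∉p : A ∈ᴸ blocks p → A ∈ᴸ map ⁅_⁆ (elements S) → ⊥
      singleton∉p A∈ A∈⁅S⁆ with ∈-map⁻ ⁅_⁆ A∈⁅S⁆
      ... | y , y∈S , refl = proj₂ (Equivalence.to (S≡Y∖W y) (∈-elements⁻ S y∈S)) (block⊆ p A∈ (x∈⁅x⁆ y))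
      blocks! : Unique (blocks p ++ map ⁅_⁆ (elements S))
      blocks! = Unique.++⁺ (blocks-unique p) (Unique.map⁺ ⁅⁆-injective (elements-unique S))
                  λ { (A∈ , A∈⁅S⁆) → singleton∉p A∈ A∈⁅S⁆ }
      ⇒ : A ∈ᴸ blocks pu → A ∈ᴸ (blocks p ++ map ⁅_⁆ (elements S))
      ⇒ {A} A∈ with Equivalence.to (lift A) A∈
      ... | inj₁ A∈p = ∈-++⁺ˡ A∈p
      ... | inj₂ (y , y∈Y , y∉W , refl) =
        ∈-++⁺ʳ (blocks p) (∈-map⁺ ⁅_⁆ (∈-elements⁺ S (Equivalence.from (S≡Y∖W y) (y∈Y , y∉W))))
      ⇐ : A ∈ᴸ (blocks p ++ map ⁅_⁆ (elements S)) → A ∈ᴸ blocks pu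
      ⇐ {A} A∈ with ∈-++⁻ (blocks p) A∈
      ... | inj₁ A∈p = Equivalence.from (lift A) (inj₁ A∈p)
      ... | inj₂ A∈⁅S⁆ with ∈-map⁻ ⁅_⁆ A∈⁅S⁆
      ... | y , y∈S , refl =
        let (y∈Y , y∉W) = Equivalence.to (S≡Y∖W y) (∈-elements⁻ S y∈S)
        in Equivalence.from (lift A) (inj₂ (y , y∈Y , y∉W , refl))

  module Restriction (Q : Partition V) (R : Partition Z) (res : IsRestriction Q R) where

    restriction-block : C ∈ᴸ blocks R → ∃ λ B → B ∈ᴸ blocks Q × C ≡ B ∩ Z
    restriction-block {C} C∈ = proj₁ (Equivalence.to (res C) C∈)

    meeting-block∈restriction : B ∈ᴸ blocks Q → Nonempty (B ∩ Z) → (B ∩ Z) ∈ᴸ blocks R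
    meeting-block∈restriction {B} B∈ B∩Z≠∅ = Equivalence.from (res (B ∩ Z)) ((B , B∈ , refl) , B∩Z≠∅)

    restriction-⊑ : blocks R ⊑ blocks Q
    restriction-⊑ = All.tabulate within-block
      where
      within-block : C ∈ᴸ blocks R → Any (C ⊆_) (blocks Q)
      within-block C∈ with restriction-block C∈
      ... | B , B∈ , refl = lose B∈ (p∩q⊆p B Z)

    ⊑-restriction : ∀ (P : Partition Z) → blocks P ⊑ blocks Q → blocks P ⊑ blocks R
    ⊑-restriction P P⊑Q = All.tabulate λ {A} A∈ →
      let (B , B∈ , A⊆B) = coarser-block P⊑Q A∈
          A⊆B∩Z : A ⊆ B ∩ Z
          A⊆B∩Z x∈A = x∈p∩q⁺ (A⊆B x∈A , block⊆ P A∈ x∈A)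
          (z , z∈A) = All.lookup (nonempty P) A∈
      in lose (meeting-block∈restriction B∈ (z , A⊆B∩Z z∈A)) A⊆B∩Z

    restriction-⊆ : Z ⊆ V
    restriction-⊆ x∈Z with block-containing R x∈Z
    ... | C , C∈ , x∈C with restriction-block C∈
    ... | B , B∈ , refl = block⊆ Q B∈ (proj₁ (x∈p∩q⁻ B Z x∈C))

    module _ (meets : AllBlocksMeet Q Z) where

      #-restriction : # R ≡ # Q
      #-restriction = begin
        # R                            ≡⟨ #-≡-length R cut-unique (mk⇔ ⇒ ⇐) ⟩
        length (map (_∩ Z) (blocks Q)) ≡⟨ length-map (_∩ Z) (blocks Q) ⟩
        # Q                            ∎
        where
        open ≡-Reasoning
        cut-unique : Unique (map (_∩ Z) (blocks Q))
        cut-unique = nonempty∧disjoint⇒unique (All.map⁺ (All.tabulate meets))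
                       (AllPairs.map⁺ (AllPairs.map (∩-disjoint Z) (disjoint Q)))
        ⇒ : C ∈ᴸ blocks R → C ∈ᴸ map (_∩ Z) (blocks Q)
        ⇒ C∈ with restriction-block C∈
        ... | B , B∈ , refl = ∈-map⁺ (_∩ Z) B∈
        ⇐ : C ∈ᴸ map (_∩ Z) (blocks Q) → C ∈ᴸ blocks R
        ⇐ C∈ with ∈-map⁻ (_∩ Z) C∈
        ... | B , B∈ , refl = meeting-block∈restriction B∈ (meets B∈)

      IsSingleBlock-restriction : IsSingleBlock Q ⇔ IsSingleBlock R
      IsSingleBlock-restriction = mk⇔ single⇒ single⇐
        where
        V∩Z≡Z : V ∩ Z ≡ Z
        V∩Z≡Z = ⊆⇒∩≡ restriction-⊆

        single⇒ : IsSingleBlock Q → IsSingleBlock R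
        single⇒ Q≡V C = mk⇔ C≡Z Z∈R
          where
          C≡Z : C ∈ᴸ blocks R → C ≡ Z
          C≡Z C∈ with restriction-block C∈
          ... | B , B∈ , refl = trans (cong (_∩ Z) (Equivalence.to (Q≡V B) B∈)) V∩Z≡Z
          Z∈R : C ≡ Z → C ∈ᴸ blocks R
          Z∈R refl = subst (_∈ᴸ blocks R) V∩Z≡Z (meeting-block∈restriction V∈Q (meets V∈Q))
            where V∈Q = Equivalence.from (Q≡V V) refl

        single⇐ : IsSingleBlock R → IsSingleBlock Q
        single⇐ R≡Z with All.lookup (nonempty R) (Equivalence.from (R≡Z Z) refl)
        ... | y , y∈Z = λ C → mk⇔ C≡V (λ { refl → V∈Q })
          where
          y∈block : B ∈ᴸ blocks Q → y ∈ B
          y∈block {B} B∈ = proj₁ (x∈p∩q⁻ B Z (subst (y ∈_) (sym B∩Z≡Z) y∈Z))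
            where B∩Z≡Z = Equivalence.to (R≡Z (B ∩ Z)) (meeting-block∈restriction B∈ (meets B∈))
          C≡V : C ∈ᴸ blocks Q → C ≡ V
          C≡V C∈ = ⊆-antisym (block⊆ Q C∈) λ x∈V →
            let (D , D∈ , x∈D) = block-containing Q x∈V
            in subst (_ ∈_) (blocks-≡ Q D∈ C∈ (y∈block D∈) (y∈block C∈)) x∈D
          V∈Q : V ∈ᴸ blocks Q
          V∈Q = let (D , D∈ , _) = block-containing Q (restriction-⊆ y∈Z)
                in subst (_∈ᴸ blocks Q) (C≡V D∈) D∈

  module _ (P : Partition V) (Z⊆V : Z ⊆ V) where

    nonempty-traces : List (Subset n)
    nonempty-traces = filter nonempty? (map (_∩ Z) (blocks P))

    restrict : Partition Z
    restrict = record
      { blocks   = nonempty-traces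
      ; nonempty = All.all-filter nonempty? (map (_∩ Z) (blocks P))
      ; disjoint = AllPairs.filter⁺ nonempty? (AllPairs.map⁺ (AllPairs.map (∩-disjoint Z) (disjoint P)))
      ; cover    = λ x → mk⇔ covered covered⁻
      }
      where
      covered : x ∈ Z → Any (x ∈_) nonempty-traces
      covered x∈Z =
        let (B , B∈ , x∈B) = block-containing P (Z⊆V x∈Z)
            x∈B∩Z = x∈p∩q⁺ (x∈B , x∈Z)
        in lose (∈-filter⁺ nonempty? (∈-map⁺ (_∩ Z) B∈) (_ , x∈B∩Z)) x∈B∩Z
      covered⁻ : Any (x ∈_) nonempty-traces → x ∈ Z
      covered⁻ x∈ with find x∈
      ... | C , C∈ , x∈C with ∈-map⁻ (_∩ Z) (proj₁ (∈-filter⁻ nonempty? {xs = map (_∩ Z) (blocks P)} C∈))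
      ... | B , _ , refl = proj₂ (x∈p∩q⁻ B Z x∈C)

    restrict-IsRestriction : IsRestriction P restrict
    restrict-IsRestriction C = mk⇔ ⇒ ⇐
      where
      ⇒ : C ∈ᴸ nonempty-traces → (Σ (Subset n) λ B → B ∈ᴸ blocks P × C ≡ B ∩ Z) × Nonempty C
      ⇒ C∈ with ∈-filter⁻ nonempty? {xs = map (_∩ Z) (blocks P)} C∈
      ... | C∈traces , C≠∅ = ∈-map⁻ (_∩ Z) C∈traces , C≠∅
      ⇐ : (Σ (Subset n) λ B → B ∈ᴸ blocks P × C ≡ B ∩ Z) × Nonempty C → C ∈ᴸ nonempty-traces
      ⇐ ((B , B∈ , refl) , C≠∅) = ∈-filter⁺ nonempty? (∈-map⁺ (_∩ Z) B∈) C≠∅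

  -- Glue together the q-blocks meeting each block of r: a partition of V whose trace on Z is r.
  module Saturation (Z⊆V : Z ⊆ V) (q : Partition V) (meets : AllBlocksMeet q Z) (r : Partition Z)
                    (qd : Partition Z) (res : IsRestriction q qd) (qd⊑r : blocks qd ⊑ blocks r) where

    open Restriction q qd res using (meeting-block∈restriction)

    saturate : Subset n → Subset n
    saturate C = ⋃ (filter (λ B → nonempty? (B ∩ C)) (blocks q))

    ∈-saturate⁺ : B ∈ᴸ blocks q → x ∈ B → Nonempty (B ∩ C) → x ∈ saturate C
    ∈-saturate⁺ B∈ x∈B B∩C≠∅ = ∈-⋃⁺ (lose (∈-filter⁺ (λ B → nonempty? (B ∩ _)) B∈ B∩C≠∅) x∈B)

    ∈-saturate⁻ : x ∈ saturate C → ∃ λ B → B ∈ᴸ blocks q × x ∈ B × Nonempty (B ∩ C)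
    ∈-saturate⁻ {C = C} x∈ with find (∈-⋃⁻ _ x∈)
    ... | B , B∈ , x∈B with ∈-filter⁻ (λ B → nonempty? (B ∩ C)) {xs = blocks q} B∈
    ... | B∈q , B∩C≠∅ = B , B∈q , x∈B , B∩C≠∅

    block⊆saturate : B ∈ᴸ blocks q → x ∈ B → x ∈ saturate C → B ⊆ saturate C
    block⊆saturate B∈ x∈B x∈ with ∈-saturate⁻ x∈
    ... | B' , B'∈ , x∈B' , B'∩C≠∅ with blocks-≡ q B'∈ B∈ x∈B' x∈B
    ... | refl = λ y∈B → ∈-saturate⁺ B∈ y∈B B'∩C≠∅

    r-block⊆saturate : C ∈ᴸ blocks r → C ⊆ saturate C
    r-block⊆saturate C∈ x∈C =
      let (B , B∈ , x∈B) = block-containing q (Z⊆V (block⊆ r C∈ x∈C))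
      in ∈-saturate⁺ B∈ x∈B (_ , x∈p∩q⁺ (x∈B , x∈C))

    q-block⊆saturate : B ∈ᴸ blocks q → ∃ λ C → C ∈ᴸ blocks r × B ⊆ saturate C
    q-block⊆saturate {B} B∈ with meets B∈
    ... | y , y∈B∩Z with x∈p∩q⁻ B Z y∈B∩Z
    ... | y∈B , y∈Z with block-containing r y∈Z
    ... | C , C∈ , y∈C = C , C∈ , λ x∈B → ∈-saturate⁺ B∈ x∈B (y , x∈p∩q⁺ (y∈B , y∈C))

    -- Since q↓Z refines r, a q-block meeting the r-block C has its whole trace on Z inside C.
    saturate-∩ : C ∈ᴸ blocks r → x ∈ saturate C → x ∈ Z → x ∈ C
    saturate-∩ C∈ x∈ x∈Z with ∈-saturate⁻ x∈
    ... | B , B∈ , x∈B , (y , y∈B∩C) with x∈p∩q⁻ B _ y∈B∩C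
    ... | y∈B , y∈C with coarser-block qd⊑r (meeting-block∈restriction B∈ (meets B∈))
    ... | C' , C'∈ , B∩Z⊆C' with blocks-≡ r C'∈ C∈ (B∩Z⊆C' (x∈p∩q⁺ (y∈B , block⊆ r C∈ y∈C))) y∈C
    ... | refl = B∩Z⊆C' (x∈p∩q⁺ (x∈B , x∈Z))

    saturate-disjoint : C ∈ᴸ blocks r → D ∈ᴸ blocks r → Disjoint C D → Disjoint (saturate C) (saturate D)
    saturate-disjoint C∈ D∈ C#D (x , x∈) with x∈p∩q⁻ (saturate _) (saturate _) x∈
    ... | x∈satC , x∈satD with ∈-saturate⁻ x∈satD
    ... | B , B∈ , x∈B , (y , y∈B∩D) with x∈p∩q⁻ B _ y∈B∩D
    ... | y∈B , y∈D =
      C#D (y , x∈p∩q⁺ (saturate-∩ C∈ (block⊆saturate B∈ x∈B x∈satC y∈B) (block⊆ r D∈ y∈D) , y∈D))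

    saturation : Partition V
    saturation = record
      { blocks   = map saturate (blocks r)
      ; nonempty = All.map⁺ (All.tabulate λ C∈ →
                     let (z , z∈C) = All.lookup (nonempty r) C∈ in z , r-block⊆saturate C∈ z∈C)
      ; disjoint = AllPairs.map⁺ (AllPairs-map-within (All.tabulate id) saturate-disjoint (disjoint r))
      ; cover    = λ x → mk⇔ covered λ x∈ →
                     let (C , _ , x∈satC) = find (Any.map⁻ x∈)
                         (B , B∈ , x∈B , _) = ∈-saturate⁻ x∈satC
                     in block⊆ q B∈ x∈B
      }
      where
      covered : x ∈ V → Any (x ∈_) (map saturate (blocks r))
      covered x∈V =
        let (B , B∈ , x∈B) = block-containing q x∈V
            (C , C∈ , B⊆satC) = q-block⊆saturate B∈
        in Any.map⁺ (lose C∈ (B⊆satC x∈B))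

    r⊑saturation : blocks r ⊑ blocks saturation
    r⊑saturation = All.tabulate λ C∈ → Any.map⁺ (lose C∈ (r-block⊆saturate C∈))

    q⊑saturation : blocks q ⊑ blocks saturation
    q⊑saturation = All.tabulate λ B∈ →
      let (C , C∈ , B⊆satC) = q-block⊆saturate B∈ in Any.map⁺ (lose C∈ B⊆satC)

    saturation-restriction : ∀ (P : Partition V) (R : Partition Z) →
                             IsRestriction P R → blocks P ⊑ blocks saturation → blocks R ⊑ blocks r
    saturation-restriction P R resR P⊑sat = All.tabulate within-block
      where
      within-block : A ∈ᴸ blocks R → Any (A ⊆_) (blocks r)
      within-block A∈ with Restriction.restriction-block P R resR A∈
      ... | D , D∈ , refl with coarser-block P⊑sat D∈
      ... | K , K∈ , D⊆K with ∈-map⁻ saturate K∈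
      ... | C , C∈ , refl = lose C∈ λ x∈D∩Z →
        let (x∈D , x∈Z) = x∈p∩q⁻ D Z x∈D∩Z in saturate-∩ C∈ (D⊆K x∈D) x∈Z

  join-restriction : Z ⊆ V → (q : Partition V) → AllBlocksMeet q Z
    → (p : Partition Z) (pu : Partition V) → IsLift p pu
    → (qd : Partition Z) → IsRestriction q qd
    → (j₁ : Partition V) → IsJoin pu q j₁
    → (j₂ : Partition Z) → IsJoin p qd j₂
    → IsRestriction j₁ j₂
  join-restriction Z⊆V q meets p pu lift qd res
                   j₁ (pu⊑j₁ , q⊑j₁ , j₁-least) j₂ (p⊑j₂ , qd⊑j₂ , j₂-least) C =
    ⇔.trans (mk⇔ (⊑-antisym j₂ j₂⊑R R⊑j₂) (⊑-antisym R R⊑j₂ j₂⊑R)) (restrict-IsRestriction j₁ Z⊆V C)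
    where
    R = restrict j₁ Z⊆V
    open Restriction j₁ R (restrict-IsRestriction j₁ Z⊆V) using (⊑-restriction)
    open Saturation Z⊆V q meets j₂ qd res qd⊑j₂
    j₂⊑R : blocks j₂ ⊑ blocks R
    j₂⊑R = j₂-least R (⊑-restriction p (⊑-trans (Lift.⊑-lift p pu lift) pu⊑j₁))
                      (⊑-restriction qd (⊑-trans (Restriction.restriction-⊑ q qd res) q⊑j₁))
    j₁⊑saturation : blocks j₁ ⊑ blocks saturation
    j₁⊑saturation = j₁-least saturation (Lift.lift-⊑ p pu lift saturation (⊑-trans p⊑j₂ r⊑saturation))
                                        q⊑saturation
    R⊑j₂ : blocks R ⊑ blocks j₂
    R⊑j₂ = saturation-restriction j₁ R (restrict-IsRestriction j₁ Z⊆V) j₁⊑saturation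

+-cancel-shared-⇔ : ∀ {v a b c d e f k z : ℕ} → v ≡ k + z → b ≡ a → c ≡ d + k → f ≡ e
                    → (v + a ≡ c + e) ⇔ (z + b ≡ d + f)
+-cancel-shared-⇔ {a = a} {d = d} {e = e} {k = k} {z = z} v≡k+z b≡a c≡d+k f≡e
  rewrite v≡k+z | b≡a | c≡d+k | f≡e =
  mk⇔ (λ eq → +-cancelˡ-≡ k (z + a) (d + e) (trans (sym lhs) (trans eq rhs)))
      (λ eq → trans lhs (trans (cong (k +_) eq) (sym rhs)))
  where
  lhs : k + z + a ≡ k + (z + a)
  lhs = +-assoc k z a
  rhs : d + k + e ≡ k + (d + e)
  rhs = trans (cong (_+ e) (+-comm d k)) (+-assoc k d e)

fact3p3 : ∀ {n : ℕ} (q : Partition {n} ⊤) (X : Subset n)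
    → (∀ B → B ∈ᴸ blocks q → ¬ (B ⊆ X))
    → (p : Partition (∁ X))
    → (pu : Partition {n} ⊤) → IsLift p pu
    → (qd : Partition (∁ X)) → IsRestriction q qd
    → (j₁ : Partition {n} ⊤) → IsJoin pu q j₁
    → (j₂ : Partition (∁ X)) → IsJoin p qd j₂
    → (IsSingleBlock j₁ ⇔ IsSingleBlock j₂)
    × (AcyclicWith pu q j₁ ⇔ AcyclicWith p qd j₂)
fact3p3 q X no-block⊆X p pu lift qd res j₁ J₁ j₂ J₂ =
  IsSingleBlock-restriction j₁-meets ,
  +-cancel-shared-⇔ (∣⊤∣≡∣p∣+∣∁p∣ X) (#-restriction j₁-meets) (Lift.#-lift p pu lift X X≡⊤∖∁X)
                    (Restriction.#-restriction q qd res q-meets)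
  where
  q-meets : AllBlocksMeet q (∁ X)
  q-meets {B} B∈ = ⊈⇒meets-∁ (no-block⊆X B B∈)
  j₁-meets : AllBlocksMeet j₁ (∁ X)
  j₁-meets = ⊑-meets q j₁ (proj₁ (proj₂ J₁)) q-meets
  open Restriction j₁ j₂ (join-restriction ⊆⊤ q q-meets p pu lift qd res j₁ J₁ j₂ J₂)
  X≡⊤∖∁X : ∀ x → x ∈ X ⇔ (x ∈ ⊤ × x ∉ ∁ X)
  X≡⊤∖∁X x = mk⇔ (λ x∈X → ∈⊤ , x∈p⇒x∉∁p x∈X) (x∉∁p⇒x∈p ∘ proj₂)
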